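{- For every positive integer $n$, the numerical semigroup $\langle n, n+1, n+2\rangle$ (with generating set $S=\{n,n+1,n+2\}$) is greedy in the general sense, i.e. $\mathrm{GreedyCost}_S(k)=\mathrm{MinCost}_S(k)$ for every $k\in\langle S\rangle$ with $k>0$.
   Context: For a finite set $S=\{s_1<s_2<\dots<s_t\}$ of positive integers with $\gcd(s_1,\dots,s_t)=1$, $\langle S\rangle=\{\sum_i a_i s_i : a_i\in\mathbb{N}_0\}$ is the numerical semigroup generated by $S$. A representation of $k\in\langle S\rangle$ is a vector $(a_1,\dots,a_t)\in\mathbb{N}_0^t$ with $\sum_i a_i s_i=k$; its cost is $\sum_i a_i$. $\mathrm{MinCost}_S(k)$ is the minimum cost over all representations of $k$. The (generalized) greedy representation of $k\in\langle S\rangle$, $k>0$, is computed as follows: set $r:=k$; for $i=t,t-1,\dots,1$ let $a_i$ be the largest integer $q\ge 0$ such that $r-q s_i\in\langle S\rangle$, and replace $r$ by $r-a_i s_i$ (at the end $r=0$). $\mathrm{GreedyCost}_S(k)=\sum_i a_i$ for this vector. $S$ (equivalently $\langle S\rangle$) is called greedy (in the general sense) if $\mathrm{GreedyCost}_S(k)=\mathrm{MinCost}_S(k)$ for all $k\in\langle S\rangle$, $k>0$. -}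

module Defs where

open import Data.Nat using (ℕ; _+_; _*_; _∸_; _≤_; _<_)
open import Data.Product using (Σ; ∃; _×_; _,_)
open import Relation.Binary.PropositionalEquality using (_≡_)

Vec3 : Set
Vec3 = ℕ × ℕ × ℕ

value : ℕ → ℕ → ℕ → Vec3 → ℕ
value s₁ s₂ s₃ (a₁ , a₂ , a₃) = a₁ * s₁ + a₂ * s₂ + a₃ * s₃

cost : Vec3 → ℕ
cost (a₁ , a₂ , a₃) = a₁ + a₂ + a₃

IsRep : ℕ → ℕ → ℕ → ℕ → Vec3 → Set
IsRep s₁ s₂ s₃ k a = value s₁ s₂ s₃ a ≡ k

InSG : ℕ → ℕ → ℕ → ℕ → Set
InSG s₁ s₂ s₃ k = Σ Vec3 (λ a → IsRep s₁ s₂ s₃ k a)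

-- q is the largest integer q ≥ 0 such that r − q·s ∈ ⟨S⟩
-- (r − q·s is only meaningful, as an integer in ⟨S⟩ ⊆ ℕ, when q·s ≤ r)
IsMaxStep : ℕ → ℕ → ℕ → (s r q : ℕ) → Set
IsMaxStep s₁ s₂ s₃ s r q =
  (q * s ≤ r × InSG s₁ s₂ s₃ (r ∸ q * s))
  × (∀ q′ → q′ * s ≤ r → InSG s₁ s₂ s₃ (r ∸ q′ * s) → q′ ≤ q)

IsGreedyRep : ℕ → ℕ → ℕ → ℕ → Vec3 → Set
IsGreedyRep s₁ s₂ s₃ k (a₁ , a₂ , a₃) =
  IsMaxStep s₁ s₂ s₃ s₃ k a₃
  × IsMaxStep s₁ s₂ s₃ s₂ (k ∸ a₃ * s₃) a₂
  × IsMaxStep s₁ s₂ s₃ s₁ (k ∸ a₃ * s₃ ∸ a₂ * s₂) a₁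

IsGreedy : ℕ → ℕ → ℕ → Set
IsGreedy s₁ s₂ s₃ =
  ∀ k → 0 < k → InSG s₁ s₂ s₃ k →
    (Σ Vec3 (λ g → IsGreedyRep s₁ s₂ s₃ k g))
    × (∀ g → IsGreedyRep s₁ s₂ s₃ k g →
         IsRep s₁ s₂ s₃ k g
         × (∀ b → IsRep s₁ s₂ s₃ k b → cost g ≤ cost b))

{-# OPTIONS --safe #-}
-- Write m = n + 1. A representation a of k has cost a · (m + 2) = k + (2a₁ + a₂), so minimising the
-- cost means keeping the deficit 2a₁ + a₂ below m + 2; and ⟨m, m+1, m+2⟩ is the union of the intervals
-- [c·m, c·(m+2)], c ∈ ℕ. Each greedy step leaves a remainder from which its generator can no longer be
-- removed inside the semigroup; hence the final remainder is 0, and the greedy deficit is at most m + 1,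
-- since otherwise one more m + 2 (or, when a₂ = 0, one more m + 1) could have been taken.
module Submission where

open import Data.Nat using (ℕ; zero; suc; _+_; _*_; _∸_; _≤_; _<_; _≤?_; NonZero; z≤n; s≤s; s≤s⁻¹)
open import Data.Nat.Properties
open import Data.Nat.Tactic.RingSolver using (solve)
open import Data.List using (_∷_; [])
open import Data.Product using (∃; _×_; _,_; proj₁; proj₂)
open import Data.Sum using (_⊎_; inj₁; inj₂; [_,_]′)
open import Data.Empty using (⊥-elim)
open import Relation.Nullary using (¬_; yes; no; contradiction)
open import Relation.Nullary.Decidable using (map′; _×-dec_)
open import Relation.Unary using (Pred; Decidable)
open import Relation.Binary.PropositionalEquality using (_≡_; refl; sym; trans; cong; subst; module ≡-Reasoning)
open import Defs

greatest : ∀ {p} {P : Pred ℕ p} → Decidable P → ∀ bound → P 0 → (∀ {q} → P q → q ≤ bound) →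
           ∃ λ q → P q × (∀ {q′} → P q′ → q′ ≤ q)
greatest P? zero P0 bounded = 0 , P0 , bounded
greatest {P = P} P? (suc b) P0 bounded with P? (suc b)
... | yes P[1+b] = suc b , P[1+b] , bounded
... | no ¬P[1+b] = greatest P? b P0 bounded′
  where
  bounded′ : ∀ {q} → P q → q ≤ b
  bounded′ Pq = s≤s⁻¹ (≤∧≢⇒< (bounded Pq) λ { refl → ¬P[1+b] Pq })

module GeneralizedGreedy (s₁ s₂ s₃ : ℕ) where

  InS : ℕ → Set
  InS = InSG s₁ s₂ s₃

  infix 4 _≼_
  _≼_ : ℕ → ℕ → Set
  x ≼ y = ∃ λ z → InS z × y ≡ x + z

  InS-+ : ∀ {x y} → InS x → InS y → InS (x + y)
  InS-+ ((a₁ , a₂ , a₃) , refl) ((b₁ , b₂ , b₃) , refl) = (a₁ + b₁ , a₂ + b₂ , a₃ + b₃) , value-+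
    where
    value-+ : (a₁ + b₁) * s₁ + (a₂ + b₂) * s₂ + (a₃ + b₃) * s₃
            ≡ (a₁ * s₁ + a₂ * s₂ + a₃ * s₃) + (b₁ * s₁ + b₂ * s₂ + b₃ * s₃)
    value-+ = solve (a₁ ∷ a₂ ∷ a₃ ∷ b₁ ∷ b₂ ∷ b₃ ∷ s₁ ∷ s₂ ∷ s₃ ∷ [])

  InS-*s₁ : ∀ q → InS (q * s₁)
  InS-*s₁ q = (q , 0 , 0) , trans (+-identityʳ _) (+-identityʳ _)

  InS-*s₂ : ∀ q → InS (q * s₂)
  InS-*s₂ q = (0 , q , 0) , +-identityʳ _

  InS-*s₃ : ∀ q → InS (q * s₃)
  InS-*s₃ q = (0 , 0 , q) , refl

  ≼-+ˡ : ∀ {s x} c → InS c → s ≼ x → s ≼ c + x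
  ≼-+ˡ {s} c c∈S (z , z∈S , refl) = c + z , InS-+ c∈S z∈S , solve (c ∷ s ∷ z ∷ [])

  InS⇒≡0⊎generator≼ : ∀ {x} → InS x → x ≡ 0 ⊎ s₁ ≼ x ⊎ s₂ ≼ x ⊎ s₃ ≼ x
  InS⇒≡0⊎generator≼ ((zero , zero , zero) , refl) = inj₁ refl
  InS⇒≡0⊎generator≼ ((suc a₁ , a₂ , a₃) , refl) =
    inj₂ (inj₁ (_ , ((a₁ , a₂ , a₃) , refl) , split))
    where
    split : (s₁ + a₁ * s₁) + a₂ * s₂ + a₃ * s₃ ≡ s₁ + (a₁ * s₁ + a₂ * s₂ + a₃ * s₃)
    split = solve (a₁ ∷ a₂ ∷ a₃ ∷ s₁ ∷ s₂ ∷ s₃ ∷ [])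
  InS⇒≡0⊎generator≼ ((zero , suc a₂ , a₃) , refl) =
    inj₂ (inj₂ (inj₁ (_ , ((0 , a₂ , a₃) , refl) , split)))
    where
    split : (s₂ + a₂ * s₂) + a₃ * s₃ ≡ s₂ + (a₂ * s₂ + a₃ * s₃)
    split = +-assoc s₂ (a₂ * s₂) (a₃ * s₃)
  InS⇒≡0⊎generator≼ ((zero , zero , suc a₃) , refl) =
    inj₂ (inj₂ (inj₂ (_ , ((0 , 0 , a₃) , refl) , refl)))

  maxStep-remainder : ∀ {s r q} → IsMaxStep s₁ s₂ s₃ s r q → r ≡ q * s + (r ∸ q * s)
  maxStep-remainder ((qs≤r , _) , _) = sym (m+[n∸m]≡n qs≤r)

  maxStep-maximal : ∀ {s r q q′} → IsMaxStep s₁ s₂ s₃ s r q → q′ * s ≼ r → q′ ≤ q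
  maxStep-maximal {s} {q′ = q′} (_ , maximal) (z , z∈S , refl) =
    maximal q′ (m≤m+n _ z) (subst InS (sym (m+n∸m≡n (q′ * s) z)) z∈S)

  maxStep-irreducible : ∀ {s r q} → IsMaxStep s₁ s₂ s₃ s r q → ¬ s ≼ r ∸ q * s
  maxStep-irreducible {s} {r} {q} step (z , z∈S , remainder≡) =
    1+n≰n (maxStep-maximal step (z , z∈S , r≡))
    where
    open ≡-Reasoning
    r≡ : r ≡ suc q * s + z
    r≡ = begin
      r                   ≡⟨ maxStep-remainder step ⟩
      q * s + (r ∸ q * s) ≡⟨ cong (q * s +_) remainder≡ ⟩
      q * s + (s + z)     ≡⟨ solve (q ∷ s ∷ z ∷ []) ⟩
      suc q * s + z       ∎

  ≼-maxStep : ∀ {s r q x} → IsMaxStep s₁ s₂ s₃ s r q → InS (q * s) → x ≼ r ∸ q * s → x ≼ r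
  ≼-maxStep step qs∈S x≼remainder = subst (_ ≼_) (sym (maxStep-remainder step)) (≼-+ˡ _ qs∈S x≼remainder)

  maxStep-exists : ∀ {r} s .{{_ : NonZero s}} → Decidable InS → InS r → ∃ (IsMaxStep s₁ s₂ s₃ s r)
  maxStep-exists {r} s InS? r∈S
    with greatest (λ q → q * s ≤? r ×-dec InS? (r ∸ q * s)) r (z≤n , r∈S)
                  (λ {q} (qs≤r , _) → ≤-trans (m≤m*n q s) qs≤r)
  ... | q , step , maximal = q , step , λ q′ q′s≤r remainder∈S → maximal (q′s≤r , remainder∈S)

  greedyRep-exists : ∀ {k} .{{_ : NonZero s₁}} .{{_ : NonZero s₂}} .{{_ : NonZero s₃}} →
                     Decidable InS → InS k → ∃ (IsGreedyRep s₁ s₂ s₃ k)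
  greedyRep-exists InS? k∈S =
    let a₃ , step₃ = maxStep-exists s₃ InS? k∈S
        a₂ , step₂ = maxStep-exists s₂ InS? (proj₂ (proj₁ step₃))
        a₁ , step₁ = maxStep-exists s₁ InS? (proj₂ (proj₁ step₂))
    in (a₁ , a₂ , a₃) , step₃ , step₂ , step₁

  module _ {k a₁ a₂ a₃ : ℕ} (greedy : IsGreedyRep s₁ s₂ s₃ k (a₁ , a₂ , a₃)) where

    private
      step₃ : IsMaxStep s₁ s₂ s₃ s₃ k a₃
      step₃ = proj₁ greedy
      step₂ : IsMaxStep s₁ s₂ s₃ s₂ (k ∸ a₃ * s₃) a₂
      step₂ = proj₁ (proj₂ greedy)
      step₁ : IsMaxStep s₁ s₂ s₃ s₁ (k ∸ a₃ * s₃ ∸ a₂ * s₂) a₁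
      step₁ = proj₂ (proj₂ greedy)

    greedyRep-remainder≡0 : k ∸ a₃ * s₃ ∸ a₂ * s₂ ∸ a₁ * s₁ ≡ 0
    greedyRep-remainder≡0 with InS⇒≡0⊎generator≼ (proj₂ (proj₁ step₁))
    ... | inj₁ remainder≡0 = remainder≡0
    ... | inj₂ (inj₁ s₁≼remainder) = contradiction s₁≼remainder (maxStep-irreducible step₁)
    ... | inj₂ (inj₂ (inj₁ s₂≼remainder)) =
      contradiction (≼-maxStep step₁ (InS-*s₁ a₁) s₂≼remainder) (maxStep-irreducible step₂)
    ... | inj₂ (inj₂ (inj₂ s₃≼remainder)) =
      contradiction (≼-maxStep step₂ (InS-*s₂ a₂) (≼-maxStep step₁ (InS-*s₁ a₁) s₃≼remainder))
                    (maxStep-irreducible step₃)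

    greedyRep-remainder₁ : k ∸ a₃ * s₃ ∸ a₂ * s₂ ≡ a₁ * s₁
    greedyRep-remainder₁ = trans (maxStep-remainder step₁)
      (trans (cong (a₁ * s₁ +_) greedyRep-remainder≡0) (+-identityʳ _))

    greedyRep-remainder₂ : k ∸ a₃ * s₃ ≡ a₁ * s₁ + a₂ * s₂
    greedyRep-remainder₂ = trans (maxStep-remainder step₂)
      (trans (cong (a₂ * s₂ +_) greedyRep-remainder₁) (+-comm (a₂ * s₂) (a₁ * s₁)))

    greedyRep-isRep : IsRep s₁ s₂ s₃ k (a₁ , a₂ , a₃)
    greedyRep-isRep = sym (trans (maxStep-remainder step₃)
      (trans (cong (a₃ * s₃ +_) greedyRep-remainder₂) (+-comm (a₃ * s₃) _)))

    greedyRep-s₃⋠ : ¬ s₃ ≼ a₁ * s₁ + a₂ * s₂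
    greedyRep-s₃⋠ s₃≼ = maxStep-irreducible step₃ (subst (s₃ ≼_) (sym greedyRep-remainder₂) s₃≼)

    greedyRep-s₂⋠ : ¬ s₂ ≼ a₁ * s₁
    greedyRep-s₂⋠ s₂≼ = maxStep-irreducible step₂ (subst (s₂ ≼_) (sym greedyRep-remainder₁) s₂≼)

module Consecutive (m : ℕ) where

  open GeneralizedGreedy m (m + 1) (m + 2) public

  deficit : Vec3 → ℕ
  deficit (a₁ , a₂ , a₃) = a₁ + a₁ + a₂

  value+deficit≡cost*[m+2] : ∀ a → value m (m + 1) (m + 2) a + deficit a ≡ cost a * (m + 2)
  value+deficit≡cost*[m+2] (a₁ , a₂ , a₃) = identity
    where
    identity : a₁ * m + a₂ * (m + 1) + a₃ * (m + 2) + (a₁ + a₁ + a₂) ≡ (a₁ + a₂ + a₃) * (m + 2)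
    identity = solve (m ∷ a₁ ∷ a₂ ∷ a₃ ∷ [])

  value≤cost*[m+2] : ∀ a → value m (m + 1) (m + 2) a ≤ cost a * (m + 2)
  value≤cost*[m+2] a = ≤-trans (m≤m+n _ (deficit a)) (≤-reflexive (value+deficit≡cost*[m+2] a))

  cost*m≤value : ∀ a → cost a * m ≤ value m (m + 1) (m + 2) a
  cost*m≤value (a₁ , a₂ , a₃) = begin
    (a₁ + a₂ + a₃) * m                   ≤⟨ m≤m+n _ (a₂ + a₃ + a₃) ⟩
    (a₁ + a₂ + a₃) * m + (a₂ + a₃ + a₃)  ≡⟨ solve (m ∷ a₁ ∷ a₂ ∷ a₃ ∷ []) ⟩
    a₁ * m + a₂ * (m + 1) + a₃ * (m + 2) ∎
    where open ≤-Reasoning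

  InS-*m+ : ∀ c {e} → e ≤ c + c → InS (c * m + e)
  InS-*m+ zero z≤n = (0 , 0 , 0) , refl
  InS-*m+ (suc c) {zero} _ = subst InS identity (InS-+ (InS-*s₁ 1) (InS-*m+ c z≤n))
    where
    identity : 1 * m + (c * m + 0) ≡ suc c * m + 0
    identity = solve (m ∷ c ∷ [])
  InS-*m+ (suc c) {suc zero} _ = subst InS identity (InS-+ (InS-*s₂ 1) (InS-*m+ c z≤n))
    where
    identity : 1 * (m + 1) + (c * m + 0) ≡ suc c * m + 1
    identity = solve (m ∷ c ∷ [])
  InS-*m+ (suc c) {suc (suc e)} 2+e≤2+c+c = subst InS identity (InS-+ (InS-*s₃ 1) (InS-*m+ c e≤c+c))
    where
    identity : 1 * (m + 2) + (c * m + e) ≡ suc c * m + (2 + e)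
    identity = solve (m ∷ c ∷ e ∷ [])
    e≤c+c : e ≤ c + c
    e≤c+c = s≤s⁻¹ (≤-trans (s≤s⁻¹ 2+e≤2+c+c) (≤-reflexive (+-suc c c)))

  interval⇒InS : ∀ {k} c → c * m ≤ k → k ≤ c * (m + 2) → InS k
  interval⇒InS {k} c lo hi = subst InS (m+[n∸m]≡n lo) (InS-*m+ c (m≤n+o⇒m∸n≤o k (c * m) k≤c*m+[c+c]))
    where
    k≤c*m+[c+c] : k ≤ c * m + (c + c)
    k≤c*m+[c+c] = ≤-trans hi (≤-reflexive (solve (m ∷ c ∷ [])))

  InS⇒interval : ∀ {k} → InS k → ∃ λ c → c * m ≤ k × k ≤ c * (m + 2)
  InS⇒interval (a , refl) = cost a , cost*m≤value a , value≤cost*[m+2] a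

  InS? : .{{NonZero m}} → Decidable InS
  InS? k = map′ (λ (c , _ , lo , hi) → interval⇒InS c lo hi) bounded-interval
                (anyUpTo? (λ c → c * m ≤? k ×-dec k ≤? c * (m + 2)) (suc k))
    where
    bounded-interval : InS k → ∃ λ c → c < suc k × c * m ≤ k × k ≤ c * (m + 2)
    bounded-interval k∈S with InS⇒interval k∈S
    ... | c , lo , hi = c , s≤s (≤-trans (m≤m*n c m) lo) , lo , hi

  cost-minimal : ∀ {k} g b → IsRep m (m + 1) (m + 2) k g → IsRep m (m + 1) (m + 2) k b →
                 deficit g ≤ 1 + m → cost g ≤ cost b
  cost-minimal g b refl b-rep small = s≤s⁻¹ (*-cancelʳ-< (m + 2) (cost g) (suc (cost b)) (begin-strict
    cost g * (m + 2)           ≡⟨ value+deficit≡cost*[m+2] g ⟨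
    valueₘ g + deficit g       ≤⟨ +-monoʳ-≤ (valueₘ g) small ⟩
    valueₘ g + (1 + m)         ≡⟨ cong (_+ (1 + m)) b-rep ⟨
    valueₘ b + (1 + m)         ≤⟨ +-monoˡ-≤ (1 + m) (value≤cost*[m+2] b) ⟩
    cost b * (m + 2) + (1 + m) <⟨ +-monoʳ-< (cost b * (m + 2)) (≤-reflexive (+-comm 2 m)) ⟩
    cost b * (m + 2) + (m + 2) ≡⟨ +-comm (cost b * (m + 2)) (m + 2) ⟩
    suc (cost b) * (m + 2)     ∎))
    where
    open ≤-Reasoning
    valueₘ : Vec3 → ℕ
    valueₘ = value m (m + 1) (m + 2)

module _ (n : ℕ) where

  open Consecutive (suc n)

  large-deficit⇒reducible : ∀ a₁ a₂ → 1 + suc n < a₁ + a₁ + a₂ →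
                            suc n + 2 ≼ a₁ * suc n + a₂ * (suc n + 1) ⊎ suc n + 1 ≼ a₁ * suc n
  large-deficit⇒reducible zero          zero       ()
  large-deficit⇒reducible (suc zero)    zero       (s≤s (s≤s ()))
  large-deficit⇒reducible zero          (suc zero) (s≤s ())
  large-deficit⇒reducible a₁ (suc (suc a₂)) _ =
    inj₁ (suc a₁ * suc n + a₂ * (suc n + 1) , ((suc a₁ , a₂ , 0) , +-identityʳ _) ,
          solve (n ∷ a₁ ∷ a₂ ∷ []))
  large-deficit⇒reducible (suc D) (suc zero) large =
    inj₁ (D * suc n + n , InS-*m+ D n≤D+D , solve (n ∷ D ∷ []))
    where
    n≤D+D : n ≤ D + D
    n≤D+D = +-cancelˡ-≤ 3 n (D + D) (≤-trans large (≤-reflexive (solve (D ∷ []))))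
  -- (2 + D)·m − (m + 1) = D·m + n is in the semigroup iff n ≤ 2D; otherwise n = 2D + 1 and
  -- (2 + D)·m − (m + 2) = D·m + 2D is.
  large-deficit⇒reducible (suc (suc D)) zero large with n ≤? D + D
  ... | yes n≤D+D = inj₂ (D * suc n + n , InS-*m+ D n≤D+D , solve (n ∷ D ∷ []))
  ... | no n≰D+D = inj₁ (D * suc n + (D + D) , InS-*m+ D ≤-refl , split)
    where
    n≡1+D+D : n ≡ suc (D + D)
    n≡1+D+D = ≤-antisym (+-cancelˡ-≤ 3 n (suc (D + D)) (≤-trans large (≤-reflexive (solve (D ∷ [])))))
                        (≰⇒> n≰D+D)
    open ≡-Reasoning
    split : (2 + D) * suc n + 0 * (suc n + 1) ≡ suc n + 2 + (D * suc n + (D + D))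
    split = begin
      (2 + D) * suc n + 0 * (suc n + 1)     ≡⟨ solve (n ∷ D ∷ []) ⟩
      suc n + 1 + (D * suc n + n)           ≡⟨ cong (λ x → suc n + 1 + (D * suc n + x)) n≡1+D+D ⟩
      suc n + 1 + (D * suc n + suc (D + D)) ≡⟨ solve (n ∷ D ∷ []) ⟩
      suc n + 2 + (D * suc n + (D + D))     ∎

  greedyRep-deficit≤ : ∀ {k} g → IsGreedyRep (suc n) (suc n + 1) (suc n + 2) k g → deficit g ≤ 1 + suc n
  greedyRep-deficit≤ (a₁ , a₂ , a₃) greedy with deficit (a₁ , a₂ , a₃) ≤? 1 + suc n
  ... | yes small = small
  ... | no large  = ⊥-elim ([ greedyRep-s₃⋠ greedy , greedyRep-s₂⋠ greedy ]′
                             (large-deficit⇒reducible a₁ a₂ (≰⇒> large)))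

theorem3 : (n : ℕ) → IsGreedy (suc n) (suc n + 1) (suc n + 2)
theorem3 n k _ k∈S = greedyRep-exists InS? k∈S , λ g greedy →
  let g-rep = greedyRep-isRep greedy
  in g-rep , λ b b-rep → cost-minimal g b g-rep b-rep (greedyRep-deficit≤ n g greedy)
  where
  open Consecutive (suc n)
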